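{- Let $c=\langle\delta,\mathrm{obs}\rangle\colon S\to (FTS)^A\times O$ be a partially observable $FT(\_)^A$-coalgebra. Then, as morphisms $\overline{T}_OS_{\mathrm{obs}}\times A\to FTS$: (1) $F(\mathsf{flat}_{\mathrm{obs}})\circ(c^{\mathsf{Bel}})^\dagger=F\mu_S\circ\lambda_{TS}\circ T\delta^\dagger\circ\mathrm{st}\circ(\iota_{\mathrm{obs}}\times A)$, where $\mathrm{st}\colon TS\times A\to T(S\times A)$; and, as morphisms $S\times A\to FTS$: (2) $F(\mathsf{flat}_{\mathrm{obs}})\circ(c^{\mathsf{Bel}})^\dagger\circ(\eta^{\overline{T}}_{\mathrm{obs}}\times A)=\delta^\dagger$.
   Context: $\mathcal{C}$ is a cartesian closed category with finite products, pullbacks (fixed choice) and countable coproducts; $f^\dagger$ denotes adjoint transpose ($\delta^\dagger\colon S\times A\to FTS$, $(c^{\mathsf{Bel}})^\dagger\colon\overline{T}_OS_{\mathrm{obs}}\times A\to FT(\overline{T}_OS_{\mathrm{obs}})$). $\mathcal{O}$ is a wide subcategory. $T=(T,\eta,\mu)$ is a strong monad, $F$ a strong endofunctor, $\mathrm{st}$ their strengths (used on either side via symmetry). $\lambda\colon TF\Rightarrow FT$ is a distributive law ($\lambda_X\circ\eta_{FX}=F\eta_X$, $F\mu_X\circ\lambda_{TX}\circ T\lambda_X=\lambda_X\circ\mu_{FX}$) with $\lambda_{X\times Y}\circ T(\mathrm{st}^F)\circ\mathrm{st}^T=F\mathrm{st}^T\circ\mathrm{st}^F\circ(X\times\lambda_Y)$.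 $A$ is a fixed object. For $f\colon X\to O$, $\overline{T}_O(f)\colon\overline{T}_OX_f\to O$ and $\iota_f\colon\overline{T}_OX_f\to TX$ form the chosen pullback of $\eta_O$ along $Tf$; this gives a monad $\overline{T}_O$ on $\mathcal{C}/O$ with unit $\eta^{\overline{T}}_f\colon X\to\overline{T}_OX_f$ induced by $(\eta_X,f)$; $d\colon\mathcal{C}/O\to\mathcal{C}$ forgetful; $\theta_{u,f}$ ($u\colon O\to O'$) induced by $(\iota_f,u\circ\overline{T}_O(f))$; $\mathsf{flat}_f:=\mu_X\circ T\iota_f$. A fixed belief decomposition: natural transformations $\alpha^O\colon Td\Rightarrow Td\overline{T}_O$, one per object $O$, with $\mathsf{flat}_f\circ\alpha^O_f=\mathrm{id}$ and $T(\theta_{u,f})\circ\alpha^O_f=\alpha^{O'}_{u\circ f}$ for $u$ in $\mathcal{O}$. Let $\kappa_Y\colon T(Y^A)\to (TY)^A$ be the transpose of $T(\mathrm{ev})\circ\mathrm{st}\colon T(Y^A)\times A\to TY$, $\lambda'_X:=(\lambda_X)^A\circ\kappa_{FX}$, and $c^{\mathsf{Bel}}:=(F\alpha^O_{\mathrm{obs}})^A\circ(F\mu_S)^A\circ\lambda'_{TS}\circ T\delta\circ\iota_{\mathrm{obs}}\colon\overline{T}_OS_{\mathrm{obs}}\to (FT(\overline{T}_OS_{\mathrm{obs}}))^A$. -}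

module Defs where

open import Level using (Level; _⊔_) renaming (suc to lsuc)
open import Data.Nat using (ℕ)
open import Relation.Binary.PropositionalEquality
open ≡-Reasoning

record Setting (o ℓ : Level) : Set (lsuc (o ⊔ ℓ)) where
  infixr 9 _∘_
  infix 4 _⇒_
  field
    Obj   : Set o
    _⇒_   : Obj → Obj → Set ℓ
    id    : {X : Obj} → X ⇒ X
    _∘_   : {X Y Z : Obj} → Y ⇒ Z → X ⇒ Y → X ⇒ Z
    assoc : {W X Y Z : Obj} {f : W ⇒ X} {g : X ⇒ Y} {h : Y ⇒ Z} →
            (h ∘ g) ∘ f ≡ h ∘ (g ∘ f)
    idˡ   : {X Y : Obj} {f : X ⇒ Y} → id ∘ f ≡ f
    idʳ   : {X Y : Obj} {f : X ⇒ Y} → f ∘ id ≡ f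

    𝟙         : Obj
    !         : {X : Obj} → X ⇒ 𝟙
    !-unique  : {X : Obj} (f : X ⇒ 𝟙) → f ≡ !

    _⊗_       : Obj → Obj → Obj
    π₁        : {X Y : Obj} → X ⊗ Y ⇒ X
    π₂        : {X Y : Obj} → X ⊗ Y ⇒ Y
    ⟨_,_⟩     : {W X Y : Obj} → W ⇒ X → W ⇒ Y → W ⇒ X ⊗ Y
    π₁-β      : {W X Y : Obj} {f : W ⇒ X} {g : W ⇒ Y} → π₁ ∘ ⟨ f , g ⟩ ≡ f
    π₂-β      : {W X Y : Obj} {f : W ⇒ X} {g : W ⇒ Y} → π₂ ∘ ⟨ f , g ⟩ ≡ g
    ⟨⟩-unique : {W X Y : Obj} {f : W ⇒ X} {g : W ⇒ Y} (h : W ⇒ X ⊗ Y) →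
                π₁ ∘ h ≡ f → π₂ ∘ h ≡ g → h ≡ ⟨ f , g ⟩

  infixr 7 _⊗_
  infixr 7 _⊗₁_

  _⊗₁_ : {X X' Y Y' : Obj} → X ⇒ X' → Y ⇒ Y' → X ⊗ Y ⇒ X' ⊗ Y'
  f ⊗₁ g = ⟨ f ∘ π₁ , g ∘ π₂ ⟩

  swap : {X Y : Obj} → X ⊗ Y ⇒ Y ⊗ X
  swap = ⟨ π₂ , π₁ ⟩

  assocʳ : {X Y Z : Obj} → (X ⊗ Y) ⊗ Z ⇒ X ⊗ (Y ⊗ Z)
  assocʳ = ⟨ π₁ ∘ π₁ , ⟨ π₂ ∘ π₁ , π₂ ⟩ ⟩

  field
    _^_          : Obj → Obj → Obj
    ev           : {A Y : Obj} → (Y ^ A) ⊗ A ⇒ Y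
    curry        : {X A Y : Obj} → X ⊗ A ⇒ Y → X ⇒ Y ^ A
    ev-β         : {X A Y : Obj} (f : X ⊗ A ⇒ Y) → ev ∘ (curry f ⊗₁ id) ≡ f
    curry-unique : {X A Y : Obj} (f : X ⊗ A ⇒ Y) (g : X ⇒ Y ^ A) →
                   ev ∘ (g ⊗₁ id) ≡ f → g ≡ curry f

    Pb        : {X Y Z : Obj} → X ⇒ Z → Y ⇒ Z → Obj
    pb₁       : {X Y Z : Obj} {f : X ⇒ Z} {g : Y ⇒ Z} → Pb f g ⇒ X
    pb₂       : {X Y Z : Obj} {f : X ⇒ Z} {g : Y ⇒ Z} → Pb f g ⇒ Y
    pb-comm   : {X Y Z : Obj} {f : X ⇒ Z} {g : Y ⇒ Z} → f ∘ pb₁ {f = f} {g} ≡ g ∘ pb₂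
    pb-med    : {W X Y Z : Obj} {f : X ⇒ Z} {g : Y ⇒ Z} (h : W ⇒ X) (k : W ⇒ Y) →
                f ∘ h ≡ g ∘ k → W ⇒ Pb f g
    pb-β₁     : {W X Y Z : Obj} {f : X ⇒ Z} {g : Y ⇒ Z} {h : W ⇒ X} {k : W ⇒ Y}
                (e : f ∘ h ≡ g ∘ k) → pb₁ ∘ pb-med h k e ≡ h
    pb-β₂     : {W X Y Z : Obj} {f : X ⇒ Z} {g : Y ⇒ Z} {h : W ⇒ X} {k : W ⇒ Y}
                (e : f ∘ h ≡ g ∘ k) → pb₂ ∘ pb-med h k e ≡ k
    pb-unique : {W X Y Z : Obj} {f : X ⇒ Z} {g : Y ⇒ Z} {h : W ⇒ X} {k : W ⇒ Y}
                (e : f ∘ h ≡ g ∘ k) (u : W ⇒ Pb f g) →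
                pb₁ ∘ u ≡ h → pb₂ ∘ u ≡ k → u ≡ pb-med h k e

    ∐              : (ℕ → Obj) → Obj
    inj            : {Xs : ℕ → Obj} (i : ℕ) → Xs i ⇒ ∐ Xs
    copair         : {Xs : ℕ → Obj} {Y : Obj} → ((i : ℕ) → Xs i ⇒ Y) → ∐ Xs ⇒ Y
    copair-β       : {Xs : ℕ → Obj} {Y : Obj} (fs : (i : ℕ) → Xs i ⇒ Y) (i : ℕ) →
                     copair fs ∘ inj i ≡ fs i
    copair-unique  : {Xs : ℕ → Obj} {Y : Obj} (fs : (i : ℕ) → Xs i ⇒ Y) (h : ∐ Xs ⇒ Y) →
                     ((i : ℕ) → h ∘ inj i ≡ fs i) → h ≡ copair fs

    -- wide subcategory 𝒪 (all objects, morphisms closed under id and ∘)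
    inO   : {X Y : Obj} → X ⇒ Y → Set ℓ
    inO-id : {X : Obj} → inO (id {X})
    inO-∘  : {X Y Z : Obj} {g : Y ⇒ Z} {f : X ⇒ Y} → inO g → inO f → inO (g ∘ f)

    T₀     : Obj → Obj
    T₁     : {X Y : Obj} → X ⇒ Y → T₀ X ⇒ T₀ Y
    T-id   : {X : Obj} → T₁ (id {X}) ≡ id
    T-∘    : {X Y Z : Obj} {f : X ⇒ Y} {g : Y ⇒ Z} → T₁ (g ∘ f) ≡ T₁ g ∘ T₁ f
    η      : {X : Obj} → X ⇒ T₀ X
    μ      : {X : Obj} → T₀ (T₀ X) ⇒ T₀ X
    η-nat  : {X Y : Obj} {f : X ⇒ Y} → T₁ f ∘ η ≡ η ∘ f
    μ-nat  : {X Y : Obj} {f : X ⇒ Y} → T₁ f ∘ μ ≡ μ ∘ T₁ (T₁ f)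
    μ-ηˡ   : {X : Obj} → μ ∘ η {T₀ X} ≡ id
    μ-ηʳ   : {X : Obj} → μ ∘ T₁ (η {X}) ≡ id
    μ-assoc : {X : Obj} → μ {X} ∘ T₁ μ ≡ μ ∘ μ

    stT       : {X Y : Obj} → X ⊗ T₀ Y ⇒ T₀ (X ⊗ Y)
    stT-nat   : {X X' Y Y' : Obj} {f : X ⇒ X'} {g : Y ⇒ Y'} →
                T₁ (f ⊗₁ g) ∘ stT ≡ stT ∘ (f ⊗₁ T₁ g)
    stT-unit  : {Y : Obj} → T₁ π₂ ∘ stT {𝟙} {Y} ≡ π₂
    stT-assoc : {X Y Z : Obj} →
                T₁ (assocʳ {X} {Y} {Z}) ∘ stT ≡ stT ∘ (id ⊗₁ stT) ∘ assocʳ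
    stT-η     : {X Y : Obj} → stT ∘ (id ⊗₁ η) ≡ η {X ⊗ Y}
    stT-μ     : {X Y : Obj} → stT ∘ (id ⊗₁ μ) ≡ μ ∘ T₁ stT ∘ stT {X} {T₀ Y}

    F₀        : Obj → Obj
    F₁        : {X Y : Obj} → X ⇒ Y → F₀ X ⇒ F₀ Y
    F-id      : {X : Obj} → F₁ (id {X}) ≡ id
    F-∘       : {X Y Z : Obj} {f : X ⇒ Y} {g : Y ⇒ Z} → F₁ (g ∘ f) ≡ F₁ g ∘ F₁ f
    stF       : {X Y : Obj} → X ⊗ F₀ Y ⇒ F₀ (X ⊗ Y)
    stF-nat   : {X X' Y Y' : Obj} {f : X ⇒ X'} {g : Y ⇒ Y'} →
                F₁ (f ⊗₁ g) ∘ stF ≡ stF ∘ (f ⊗₁ F₁ g)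
    stF-unit  : {Y : Obj} → F₁ π₂ ∘ stF {𝟙} {Y} ≡ π₂
    stF-assoc : {X Y Z : Obj} →
                F₁ (assocʳ {X} {Y} {Z}) ∘ stF ≡ stF ∘ (id ⊗₁ stF) ∘ assocʳ

    dl      : {X : Obj} → T₀ (F₀ X) ⇒ F₀ (T₀ X)
    dl-nat  : {X Y : Obj} {f : X ⇒ Y} → dl ∘ T₁ (F₁ f) ≡ F₁ (T₁ f) ∘ dl
    dl-η    : {X : Obj} → dl {X} ∘ η ≡ F₁ η
    dl-μ    : {X : Obj} → F₁ μ ∘ dl ∘ T₁ dl ≡ dl {X} ∘ μ
    dl-st   : {X Y : Obj} →
              dl {X ⊗ Y} ∘ T₁ stF ∘ stT ≡ F₁ stT ∘ stF ∘ (id ⊗₁ dl)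

  stT' : {X Y : Obj} → T₀ X ⊗ Y ⇒ T₀ (X ⊗ Y)
  stT' = T₁ swap ∘ stT ∘ swap

  _† : {X A Y : Obj} → X ⇒ Y ^ A → X ⊗ A ⇒ Y
  f † = ev ∘ (f ⊗₁ id)

  _^₁_ : {Y Z : Obj} → Y ⇒ Z → (A : Obj) → Y ^ A ⇒ Z ^ A
  g ^₁ A = curry (g ∘ ev)

  κ : (A Y : Obj) → T₀ (Y ^ A) ⇒ T₀ Y ^ A
  κ A Y = curry (T₁ ev ∘ stT')

  λ' : (A X : Obj) → T₀ (F₀ X ^ A) ⇒ F₀ (T₀ X) ^ A
  λ' A X = (dl ^₁ A) ∘ κ A (F₀ X)

  -- the lifted monad T̄_O on the slice 𝒞/O: for f : X → O,
  -- T̄_O X_f is the chosen pullback of η_O along T f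
  T̄ : {X O : Obj} → X ⇒ O → Obj
  T̄ {X} {O} f = Pb (T₁ f) (η {O})

  ι : {X O : Obj} (f : X ⇒ O) → T̄ f ⇒ T₀ X
  ι f = pb₁

  T̄map : {X O : Obj} (f : X ⇒ O) → T̄ f ⇒ O
  T̄map f = pb₂

  η̄ : {X O : Obj} (f : X ⇒ O) → X ⇒ T̄ f
  η̄ f = pb-med η f η-nat

  flat : {X O : Obj} (f : X ⇒ O) → T₀ (T̄ f) ⇒ T₀ X
  flat f = μ ∘ T₁ (ι f)

  θ-comm : {X O O' : Obj} (u : O ⇒ O') (f : X ⇒ O) →
           T₁ (u ∘ f) ∘ ι f ≡ η ∘ (u ∘ T̄map f)
  θ-comm u f = begin
    T₁ (u ∘ f) ∘ ι f          ≡⟨ cong (_∘ ι f) T-∘ ⟩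
    (T₁ u ∘ T₁ f) ∘ ι f       ≡⟨ assoc ⟩
    T₁ u ∘ (T₁ f ∘ ι f)       ≡⟨ cong (T₁ u ∘_) pb-comm ⟩
    T₁ u ∘ (η ∘ T̄map f)       ≡⟨ sym assoc ⟩
    (T₁ u ∘ η) ∘ T̄map f       ≡⟨ cong (_∘ T̄map f) η-nat ⟩
    (η ∘ u) ∘ T̄map f          ≡⟨ assoc ⟩
    η ∘ (u ∘ T̄map f)          ∎

  θ : {X O O' : Obj} (u : O ⇒ O') (f : X ⇒ O) → T̄ f ⇒ T̄ (u ∘ f)
  θ u f = pb-med (ι f) (u ∘ T̄map f) (θ-comm u f)

  T̄₁-comm : {X Y O : Obj} (f : X ⇒ O) (g : Y ⇒ O) (h : X ⇒ Y) → g ∘ h ≡ f →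
            T₁ g ∘ (T₁ h ∘ ι f) ≡ η ∘ T̄map f
  T̄₁-comm f g h e = begin
    T₁ g ∘ (T₁ h ∘ ι f)   ≡⟨ sym assoc ⟩
    (T₁ g ∘ T₁ h) ∘ ι f   ≡⟨ cong (_∘ ι f) (sym T-∘) ⟩
    T₁ (g ∘ h) ∘ ι f      ≡⟨ cong (λ k → T₁ k ∘ ι f) e ⟩
    T₁ f ∘ ι f            ≡⟨ pb-comm ⟩
    η ∘ T̄map f            ∎

  T̄₁ : {X Y O : Obj} (f : X ⇒ O) (g : Y ⇒ O) (h : X ⇒ Y) → g ∘ h ≡ f → T̄ f ⇒ T̄ g
  T̄₁ f g h e = pb-med (T₁ h ∘ ι f) (T̄map f) (T̄₁-comm f g h e)

record BeliefDecomposition {o ℓ : Level} (𝒞 : Setting o ℓ) : Set (o ⊔ ℓ) where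
  open Setting 𝒞
  field
    α      : {X O : Obj} (f : X ⇒ O) → T₀ X ⇒ T₀ (T̄ f)
    α-nat  : {X Y O : Obj} (f : X ⇒ O) (g : Y ⇒ O) (h : X ⇒ Y) (e : g ∘ h ≡ f) →
             T₁ (T̄₁ f g h e) ∘ α f ≡ α g ∘ T₁ h
    α-flat : {X O : Obj} (f : X ⇒ O) → flat f ∘ α f ≡ id
    α-θ    : {X O O' : Obj} (u : O ⇒ O') (f : X ⇒ O) → inO u →
             T₁ (θ u f) ∘ α f ≡ α (u ∘ f)

module Belief {o ℓ : Level} (𝒞 : Setting o ℓ) (B : BeliefDecomposition 𝒞) where
  open Setting 𝒞
  open BeliefDecomposition B

  cBel : (A S O : Obj) (δ : S ⇒ F₀ (T₀ S) ^ A) (obs : S ⇒ O) →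
         T̄ obs ⇒ F₀ (T₀ (T̄ obs)) ^ A
  cBel A S O δ obs =
    (F₁ (α obs) ^₁ A) ∘ (F₁ (μ {S}) ^₁ A) ∘ λ' A (T₀ S) ∘ T₁ δ ∘ ι obs

-- The belief coalgebra is δ pushed through λ' and then split by α; flattening
-- undoes the split because flat ∘ α = id, and transposing λ' ∘ T δ gives
-- λ ∘ T δ† ∘ st since κ is built from the strength.  For (2),
-- ι ∘ η̄ = η, the strength preserves η, and F μ ∘ λ ∘ T g ∘ η = g by the unit
-- laws of λ and μ.
module Submission where

open import Defs
open import Level using (Level)
open import Data.Product using (_×_; _,_)
open import Relation.Binary.PropositionalEquality
  using (_≡_; sym; trans; cong; cong₂; module ≡-Reasoning)

module Properties {o ℓ : Level} (𝒞 : Setting o ℓ) where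
  open Setting 𝒞
  open ≡-Reasoning

  module _ {W X Y Z : Obj} where

    pullʳ : {f : Y ⇒ Z} {a : X ⇒ Y} {b : W ⇒ X} {c : W ⇒ Y} →
            a ∘ b ≡ c → (f ∘ a) ∘ b ≡ f ∘ c
    pullʳ e = trans assoc (cong (_ ∘_) e)

    pullˡ : {a : Y ⇒ Z} {b : X ⇒ Y} {c : X ⇒ Z} {f : W ⇒ X} →
            a ∘ b ≡ c → a ∘ (b ∘ f) ≡ c ∘ f
    pullˡ e = trans (sym assoc) (cong (_∘ _) e)

  cancelˡ : {X Y Z : Obj} {a : Y ⇒ X} {b : X ⇒ Y} {f : Z ⇒ X} →
            a ∘ b ≡ id → a ∘ (b ∘ f) ≡ f
  cancelˡ e = trans (pullˡ e) idˡ

  T-square : {W X Y Z : Obj} {f : W ⇒ X} {g : X ⇒ Z} {h : W ⇒ Y} {k : Y ⇒ Z} →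
             g ∘ f ≡ k ∘ h → T₁ g ∘ T₁ f ≡ T₁ k ∘ T₁ h
  T-square e = trans (sym T-∘) (trans (cong T₁ e) T-∘)

  F-retraction : {X Y : Obj} {f : X ⇒ Y} {g : Y ⇒ X} →
                 g ∘ f ≡ id → F₁ g ∘ F₁ f ≡ id
  F-retraction e = trans (sym F-∘) (trans (cong F₁ e) F-id)

  ⟨⟩∘ : {V W X Y : Obj} {f : W ⇒ X} {g : W ⇒ Y} {h : V ⇒ W} →
        ⟨ f , g ⟩ ∘ h ≡ ⟨ f ∘ h , g ∘ h ⟩
  ⟨⟩∘ = ⟨⟩-unique _ (pullˡ π₁-β) (pullˡ π₂-β)

  ⊗₁-∘ : {X₁ X₂ X₃ Y₁ Y₂ Y₃ : Obj}
         {f : X₂ ⇒ X₃} {g : X₁ ⇒ X₂} {h : Y₂ ⇒ Y₃} {k : Y₁ ⇒ Y₂} →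
         (f ⊗₁ h) ∘ (g ⊗₁ k) ≡ (f ∘ g) ⊗₁ (h ∘ k)
  ⊗₁-∘ = trans ⟨⟩∘ (cong₂ ⟨_,_⟩ (trans (pullʳ π₁-β) (sym assoc))
                                 (trans (pullʳ π₂-β) (sym assoc)))

  swap∘⊗₁ : {X X' Y Y' : Obj} {f : X ⇒ X'} {g : Y ⇒ Y'} →
            swap ∘ (f ⊗₁ g) ≡ (g ⊗₁ f) ∘ swap
  swap∘⊗₁ = trans ⟨⟩∘ (trans (cong₂ ⟨_,_⟩ π₂-β π₁-β)
                      (sym (trans ⟨⟩∘ (cong₂ ⟨_,_⟩ (pullʳ π₁-β) (pullʳ π₂-β)))))

  swap∘swap : {X Y : Obj} → swap {Y} {X} ∘ swap ≡ id
  swap∘swap = trans ⟨⟩∘ (trans (cong₂ ⟨_,_⟩ π₂-β π₁-β) (sym (⟨⟩-unique id idʳ idʳ)))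

  †-natˡ : {X X' A Y : Obj} {h : X' ⇒ Y ^ A} {k : X ⇒ X'} →
           (h ∘ k) † ≡ h † ∘ (k ⊗₁ id)
  †-natˡ {h = h} {k} = begin
    ev ∘ ((h ∘ k) ⊗₁ id)            ≡⟨ cong (ev ∘_) (sym (trans ⊗₁-∘ (cong (_ ⊗₁_) idˡ))) ⟩
    ev ∘ ((h ⊗₁ id) ∘ (k ⊗₁ id))    ≡⟨ sym assoc ⟩
    h † ∘ (k ⊗₁ id)                 ∎

  ^₁-† : {X A Y Z : Obj} {g : Y ⇒ Z} {h : X ⇒ Y ^ A} → ((g ^₁ A) ∘ h) † ≡ g ∘ h †
  ^₁-† {A = A} {g = g} {h} = begin
    ((g ^₁ A) ∘ h) †         ≡⟨ †-natˡ ⟩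
    (g ^₁ A) † ∘ (h ⊗₁ id)   ≡⟨ cong (_∘ (h ⊗₁ id)) (ev-β _) ⟩
    (g ∘ ev) ∘ (h ⊗₁ id)     ≡⟨ assoc ⟩
    g ∘ h †                  ∎

  stT'-nat : {X X' Y : Obj} {f : X ⇒ X'} →
             stT' {X'} {Y} ∘ (T₁ f ⊗₁ id) ≡ T₁ (f ⊗₁ id) ∘ stT'
  stT'-nat {f = f} = begin
    (T₁ swap ∘ stT ∘ swap) ∘ (T₁ f ⊗₁ id)      ≡⟨ pullʳ (pullʳ swap∘⊗₁) ⟩
    T₁ swap ∘ stT ∘ (id ⊗₁ T₁ f) ∘ swap        ≡⟨ cong (T₁ swap ∘_) (pullˡ (sym stT-nat)) ⟩
    T₁ swap ∘ (T₁ (id ⊗₁ f) ∘ stT) ∘ swap      ≡⟨ cong (T₁ swap ∘_) assoc ⟩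
    T₁ swap ∘ T₁ (id ⊗₁ f) ∘ stT ∘ swap        ≡⟨ pullˡ (T-square swap∘⊗₁) ⟩
    (T₁ (f ⊗₁ id) ∘ T₁ swap) ∘ stT ∘ swap      ≡⟨ assoc ⟩
    T₁ (f ⊗₁ id) ∘ stT'                        ∎

  stT'-η : {X Y : Obj} → stT' {X} {Y} ∘ (η ⊗₁ id) ≡ η
  stT'-η = begin
    (T₁ swap ∘ stT ∘ swap) ∘ (η ⊗₁ id)   ≡⟨ pullʳ (pullʳ swap∘⊗₁) ⟩
    T₁ swap ∘ stT ∘ (id ⊗₁ η) ∘ swap     ≡⟨ cong (T₁ swap ∘_) (pullˡ stT-η) ⟩
    T₁ swap ∘ η ∘ swap                   ≡⟨ pullˡ η-nat ⟩
    (η ∘ swap) ∘ swap                    ≡⟨ pullʳ swap∘swap ⟩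
    η ∘ id                               ≡⟨ idʳ ⟩
    η                                    ∎

  κ-† : {A Y Z : Obj} {h : Z ⇒ Y ^ A} → (κ A Y ∘ T₁ h) † ≡ T₁ (h †) ∘ stT'
  κ-† {A} {Y} {h = h} = begin
    (κ A Y ∘ T₁ h) †                  ≡⟨ †-natˡ ⟩
    κ A Y † ∘ (T₁ h ⊗₁ id)            ≡⟨ cong (_∘ (T₁ h ⊗₁ id)) (ev-β _) ⟩
    (T₁ ev ∘ stT') ∘ (T₁ h ⊗₁ id)     ≡⟨ pullʳ stT'-nat ⟩
    T₁ ev ∘ T₁ (h ⊗₁ id) ∘ stT'       ≡⟨ pullˡ (sym T-∘) ⟩
    T₁ (h †) ∘ stT'                   ∎

  λ'-† : {A X Z : Obj} {h : Z ⇒ F₀ X ^ A} →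
         (λ' A X ∘ T₁ h) † ≡ dl ∘ T₁ (h †) ∘ stT'
  λ'-† = trans (cong _† assoc) (trans ^₁-† (cong (dl ∘_) κ-†))

  dl-extension-η : {X Y : Obj} {g : X ⇒ F₀ (T₀ Y)} → F₁ μ ∘ dl ∘ T₁ g ∘ η ≡ g
  dl-extension-η {g = g} = begin
    F₁ μ ∘ dl ∘ T₁ g ∘ η   ≡⟨ cong (λ z → F₁ μ ∘ dl ∘ z) η-nat ⟩
    F₁ μ ∘ dl ∘ η ∘ g      ≡⟨ cong (F₁ μ ∘_) (pullˡ dl-η) ⟩
    F₁ μ ∘ F₁ η ∘ g        ≡⟨ cancelˡ (F-retraction μ-ηˡ) ⟩
    g                      ∎

module BeliefProperties {o ℓ : Level} (𝒞 : Setting o ℓ) (B : BeliefDecomposition 𝒞) where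
  open Setting 𝒞
  open Belief 𝒞 B
  open BeliefDecomposition B
  open Properties 𝒞
  open ≡-Reasoning

  ι∘η̄ : {X O : Obj} {f : X ⇒ O} → ι f ∘ η̄ f ≡ η
  ι∘η̄ = pb-β₁ η-nat

  module _ (A S O : Obj) (δ : S ⇒ F₀ (T₀ S) ^ A) (obs : S ⇒ O) where

    flat∘cBel† : F₁ (flat obs) ∘ (cBel A S O δ obs) †
                 ≡ F₁ μ ∘ dl ∘ T₁ (δ †) ∘ stT' ∘ (ι obs ⊗₁ id)
    flat∘cBel† = begin
      F₁ (flat obs) ∘ ((F₁ (α obs) ^₁ A) ∘ (F₁ μ ^₁ A) ∘ λ' A (T₀ S) ∘ T₁ δ ∘ ι obs) †
        ≡⟨ cong (F₁ (flat obs) ∘_) ^₁-† ⟩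
      F₁ (flat obs) ∘ F₁ (α obs) ∘ ((F₁ μ ^₁ A) ∘ λ' A (T₀ S) ∘ T₁ δ ∘ ι obs) †
        ≡⟨ cancelˡ (F-retraction (α-flat obs)) ⟩
      ((F₁ μ ^₁ A) ∘ λ' A (T₀ S) ∘ T₁ δ ∘ ι obs) †
        ≡⟨ ^₁-† ⟩
      F₁ μ ∘ (λ' A (T₀ S) ∘ T₁ δ ∘ ι obs) †
        ≡⟨ cong (λ z → F₁ μ ∘ z †) (sym assoc) ⟩
      F₁ μ ∘ ((λ' A (T₀ S) ∘ T₁ δ) ∘ ι obs) †
        ≡⟨ cong (F₁ μ ∘_) (trans †-natˡ (cong (_∘ (ι obs ⊗₁ id)) λ'-†)) ⟩
      F₁ μ ∘ (dl ∘ T₁ (δ †) ∘ stT') ∘ (ι obs ⊗₁ id)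
        ≡⟨ cong (F₁ μ ∘_) (pullʳ assoc) ⟩
      F₁ μ ∘ dl ∘ T₁ (δ †) ∘ stT' ∘ (ι obs ⊗₁ id) ∎

    flat∘cBel†∘η̄ : F₁ (flat obs) ∘ (cBel A S O δ obs) † ∘ (η̄ obs ⊗₁ id) ≡ δ †
    flat∘cBel†∘η̄ = begin
      F₁ (flat obs) ∘ (cBel A S O δ obs) † ∘ (η̄ obs ⊗₁ id)
        ≡⟨ pullˡ flat∘cBel† ⟩
      (F₁ μ ∘ dl ∘ T₁ (δ †) ∘ stT' ∘ (ι obs ⊗₁ id)) ∘ (η̄ obs ⊗₁ id)
        ≡⟨ pullʳ (pullʳ (pullʳ (pullʳ (trans ⊗₁-∘ (cong₂ _⊗₁_ ι∘η̄ idˡ))))) ⟩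
      F₁ μ ∘ dl ∘ T₁ (δ †) ∘ stT' ∘ (η ⊗₁ id)
        ≡⟨ cong (λ z → F₁ μ ∘ dl ∘ T₁ (δ †) ∘ z) stT'-η ⟩
      F₁ μ ∘ dl ∘ T₁ (δ †) ∘ η
        ≡⟨ dl-extension-η ⟩
      δ † ∎

lemma6p1 : {o ℓ : Level} (𝒞 : Setting o ℓ) (B : BeliefDecomposition 𝒞) →
           let open Setting 𝒞 in let open Belief 𝒞 B in
           (A S O : Obj) (δ : S ⇒ F₀ (T₀ S) ^ A) (obs : S ⇒ O) →
           (F₁ (flat obs) ∘ (cBel A S O δ obs) †
              ≡ F₁ (μ {S}) ∘ dl {T₀ S} ∘ T₁ (δ †) ∘ stT' {S} {A} ∘ (ι obs ⊗₁ id {A}))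
           × (F₁ (flat obs) ∘ (cBel A S O δ obs) † ∘ (η̄ obs ⊗₁ id {A})
              ≡ δ †)
lemma6p1 𝒞 B A S O δ obs = flat∘cBel† A S O δ obs , flat∘cBel†∘η̄ A S O δ obs
  where open BeliefProperties 𝒞 B
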